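{- Let $I=(T_0,k,\mathcal{A},\mathcal{X})$ be an instance of \textsc{CWKIT} in which $T_0$ has $n\ge 3$ vertices. Then $I$ is a yes-instance if and only if there exists a set $B\in\mathcal{B}_n$ that contains no bad triple.
   Context: Inversion: for a digraph $D$ and tuple $\mathcal{Y}=(Y_1,\ldots,Y_\ell)$ of vertex subsets, $D\oplus\mathcal{Y}$ is obtained by successively reversing all arcs with both endpoints in $Y_1$, then $Y_2$, etc.; $\mathcal{Y}$ is a decycling family of size $\ell$ if $D\oplus\mathcal{Y}$ is acyclic. An instance of \textsc{CWKIT} consists of a tournament $T_0$ on vertices $u_1,\ldots,u_n$, an integer $k$, a tuple $\mathcal{A}=(A_1,\ldots,A_n)$ of sets $A_i\subseteq\{0,1,\ldots,k\}$ (standing assumption: each $A_i$ is nonempty), and a decycling family $\mathcal{X}=(X_1,\ldots,X_s)$ of $T_0$. It is a yes-instance iff there is a decycling family $\mathcal{Y}=(Y_1,\ldots,Y_k)$ of $T_0$ such that for each $i$ the number of $j$ with $u_i\in Y_j$ lies in $A_i$. Convention: the vertices are indexed so that $u_1,\ldots,u_n$ is a topological ordering of the transitive tournament $T=T_0\oplus\mathcal{X}$. Let $J=\{0,1\}^{s+k}$; $J_i$ is the set of $\mathbf{x}\in J$ such that for $j\le s$ the $j$-th coordinate is $1$ iff $u_i\in X_j$, and the number of $1$s among the last $k$ coordinates lies in $A_i$. For $\mathbf{u}=(\mathbf{u}_1,\ldots,\mathbf{u}_t)$ with entries in $J$, $B(\mathbf{u})=\{(\mathbf{u}_a,\mathbf{u}_b,\mathbf{u}_c):1\le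 a<b<c\le t\}$, and $\mathcal{B}_n=\{B(\mathbf{u}):\mathbf{u}=(\mathbf{u}_1,\ldots,\mathbf{u}_n),\ \mathbf{u}_i\in J_i\ \forall i\}$. A triple $(\mathbf{a},\mathbf{b},\mathbf{c})\in J^3$ is bad if $\mathbf{a}\cdot\mathbf{b}=\mathbf{b}\cdot\mathbf{c}$ and $\mathbf{a}\cdot\mathbf{b}\ne\mathbf{a}\cdot\mathbf{c}$, where $\cdot$ is the inner product over $\mathrm{GF}(2)$ (i.e. taken modulo $2$). -}

module Defs where

open import Data.Nat using (ℕ; zero; suc; _+_; _≤_)
open import Data.Bool using (Bool; true; false; _∧_; _xor_; if_then_else_)
open import Data.Fin using (Fin; _<_)
open import Data.Vec using (Vec; []; _∷_; map; zipWith; foldr; take; drop)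
open import Data.Product using (_×_; ∃)
open import Relation.Binary.PropositionalEquality using (_≡_; _≢_)
open import Relation.Nullary using (¬_)
open import Relation.Binary.Construct.Closure.Transitive using (TransClosure)

-- A digraph on the vertex set Fin n (vertex u_{i+1} is index i), given by
-- its arc indicator: arc i j ≡ true iff there is an arc i → j.
Digraph : ℕ → Set
Digraph n = Fin n → Fin n → Bool

VSet : ℕ → Set
VSet n = Fin n → Bool

IsTournament : ∀ {n} → Digraph n → Set
IsTournament {n} D = (∀ i → D i i ≡ false) × (∀ i j → i ≢ j → D i j ≢ D j i)

Arc : ∀ {n} → Digraph n → Fin n → Fin n → Set
Arc D i j = D i j ≡ true

Acyclic : ∀ {n} → Digraph n → Set
Acyclic {n} D = ∀ (i : Fin n) → ¬ TransClosure (Arc D) i i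

invert : ∀ {n} → Digraph n → VSet n → Digraph n
invert D Y i j = if Y i ∧ Y j then D j i else D i j

_⊕_ : ∀ {n ℓ} → Digraph n → Vec (VSet n) ℓ → Digraph n
D ⊕ []       = D
D ⊕ (Y ∷ Ys) = invert D Y ⊕ Ys

IsDecycling : ∀ {n ℓ} → Digraph n → Vec (VSet n) ℓ → Set
IsDecycling D Ys = Acyclic (D ⊕ Ys)

countTrue : ∀ {m} → Vec Bool m → ℕ
countTrue []          = 0
countTrue (true ∷ v)  = suc (countTrue v)
countTrue (false ∷ v) = countTrue v

multiplicity : ∀ {n ℓ} → Vec (VSet n) ℓ → Fin n → ℕ
multiplicity Ys i = countTrue (map (λ Y → Y i) Ys)

-- A_i given as a subset of ℕ (indicator); side conditions A_i ⊆ {0..k},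
-- A_i ≠ ∅ are separate hypotheses.
IsYesInstance : ∀ {n s} → Digraph n → (k : ℕ) → (Fin n → ℕ → Bool) →
                Vec (VSet n) s → Set
IsYesInstance {n} T₀ k A X =
  ∃ λ (Ys : Vec (VSet n) k) →
    IsDecycling T₀ Ys × (∀ i → A i (multiplicity Ys i) ≡ true)

_·_ : ∀ {m} → Vec Bool m → Vec Bool m → Bool
x · y = foldr _ _xor_ false (zipWith _∧_ x y)

Bad : ∀ {m} → Vec Bool m → Vec Bool m → Vec Bool m → Set
Bad a b c = (a · b ≡ b · c) × (a · b ≢ a · c)

InJ : ∀ {n s} (k : ℕ) → (Fin n → ℕ → Bool) → Vec (VSet n) s →
      Fin n → Vec Bool (s + k) → Set
InJ {s = s} k A X i x =
  (take s x ≡ map (λ Xj → Xj i) X) × (A i (countTrue (drop s x)) ≡ true)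

NoBadTriple : ∀ {n m} → (Fin n → Vec Bool m) → Set
NoBadTriple u = ∀ a b c → a < b → b < c → ¬ Bad (u a) (u b) (u c)

ExistsGoodB : ∀ {n s} (k : ℕ) → (Fin n → ℕ → Bool) → Vec (VSet n) s → Set
ExistsGoodB {n} {s} k A X =
  ∃ λ (u : Fin n → Vec Bool (s + k)) →
    (∀ i → InJ k A X i (u i)) × NoBadTriple u

{-# OPTIONS --safe #-}
-- Write xᵢ, yᵢ for the incidence vectors of the vertex uᵢ in 𝒳 and in 𝒴. In a
-- tournament the arc between uᵢ and uⱼ is reversed by T₀ ⊕ 𝒴 iff yᵢ · yⱼ = 1, so,
-- measured against the transitive tournament T₀ ⊕ 𝒳, for i < j the arc of T₀ ⊕ 𝒴
-- points backwards iff (xᵢ ++ yᵢ) · (xⱼ ++ yⱼ) = 1. A tournament is acyclic iff it has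
-- no directed triangle, and for a < b < c the triangle on uₐ, u_b, u_c is directed iff
-- the triple of these concatenated vectors is bad. Finally, the families 𝒴 and the last
-- k coordinates of the choices (𝐮ᵢ ∈ Jᵢ)ᵢ are transposes of each other, the weight of
-- the block of 𝐮ᵢ being the multiplicity of uᵢ in 𝒴.
module Submission where

open import Defs
open import Data.Nat using (ℕ; _+_; _≤_)
open import Data.Bool using (Bool; true; false; not; _∧_; _xor_)
open import Data.Bool.Properties
  using (∧-comm; xor-assoc; xor-comm; not-distribʳ-xor; not-involutive; not-injective; ¬-not)
open import Data.Fin using (Fin; _<_; _≟_)
open import Data.Fin.Properties using (<-cmp; <-trans; <⇒≢)
open import Data.Vec using (Vec; []; _∷_; map; take; drop; _++_; tabulate; lookup)
open import Data.Vec.Properties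
  using (take++drop≡id; ++-injective; tabulate-∘; tabulate∘lookup)
open import Data.Product using (∃; _,_; _×_; proj₁; proj₂)
open import Data.Product.Function.NonDependent.Propositional using (_×-⇔_)
open import Data.Sum using (_⊎_; inj₁; inj₂; [_,_]′)
open import Data.Sum.Function.Propositional using (_⊎-⇔_)
open import Data.Empty using (⊥-elim)
open import Function using (_∘_)
open import Function.Bundles using (_⇔_; mk⇔; Equivalence)
open import Function.Construct.Composition using (_⇔-∘_)
open import Function.Construct.Symmetry using (⇔-sym)
open import Relation.Binary.Definitions using (Transitive; tri<; tri≈; tri>)
open import Relation.Binary.PropositionalEquality
  using (_≡_; _≢_; refl; sym; trans; cong; cong₂; subst; module ≡-Reasoning)
open import Relation.Nullary using (¬_; yes; no)
open import Relation.Binary.Construct.Closure.Transitive using ([_]; _∷_; transitive⁻)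

open Equivalence using (to; from)

·-++ : ∀ {m l} (a c : Vec Bool m) (b d : Vec Bool l) →
       (a ++ b) · (c ++ d) ≡ (a · c) xor (b · d)
·-++ []      []      b d = refl
·-++ (x ∷ a) (y ∷ c) b d =
  trans (cong ((x ∧ y) xor_) (·-++ a c b d)) (sym (xor-assoc (x ∧ y) (a · c) (b · d)))

xor≡true⇒≡not : ∀ p {t} → p xor t ≡ true → t ≡ not p
xor≡true⇒≡not false        refl = refl
xor≡true⇒≡not true {false} refl = refl

take-drop-++ : ∀ {A : Set} m {l} (xs : Vec A m) (ys : Vec A l) →
               take m (xs ++ ys) ≡ xs × drop m (xs ++ ys) ≡ ys
take-drop-++ m xs ys = ++-injective (take m (xs ++ ys)) xs (take++drop≡id m (xs ++ ys))

incidence : ∀ {n ℓ} → Vec (VSet n) ℓ → Fin n → Vec Bool ℓ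
incidence Ys i = map (λ Y → Y i) Ys

columns : ∀ {n k} → (Fin n → Vec Bool k) → Vec (VSet n) k
columns v = tabulate (λ j i → lookup (v i) j)

incidence-columns : ∀ {n k} (v : Fin n → Vec Bool k) i → incidence (columns v) i ≡ v i
incidence-columns v i =
  trans (sym (tabulate-∘ (λ Y → Y i) (λ j i → lookup (v i) j))) (tabulate∘lookup (v i))

Cycle₃ : ∀ {n} → Digraph n → Fin n → Fin n → Fin n → Set
Cycle₃ D i j k = Arc D i j × Arc D j k × Arc D k i

module _ {n} {D : Digraph n} (tournament : IsTournament D) where

  no-loop : ∀ {i} → ¬ Arc D i i
  no-loop {i} e with trans (sym (proj₁ tournament i)) e
  ... | ()

  arc⇒≢ : ∀ {i j} → Arc D i j → i ≢ j
  arc⇒≢ e refl = no-loop e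

  converse : ∀ {i j} → i ≢ j → D j i ≡ not (D i j)
  converse i≢j = ¬-not (proj₂ tournament _ _ (i≢j ∘ sym))

  invert-tournament : ∀ Y → IsTournament (invert D Y)
  invert-tournament Y = loopless , antisymmetric
    where
    loopless : ∀ i → invert D Y i i ≡ false
    loopless i with Y i ∧ Y i
    ... | true  = proj₁ tournament i
    ... | false = proj₁ tournament i

    antisymmetric : ∀ i j → i ≢ j → invert D Y i j ≢ invert D Y j i
    antisymmetric i j i≢j rewrite ∧-comm (Y j) (Y i) with Y i ∧ Y j
    ... | true  = proj₂ tournament j i (i≢j ∘ sym)
    ... | false = proj₂ tournament i j i≢j

  invert-arc : ∀ Y {i j} → i ≢ j → invert D Y i j ≡ (Y i ∧ Y j) xor D i j
  invert-arc Y {i} {j} i≢j with Y i ∧ Y j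
  ... | true  = converse i≢j
  ... | false = refl

  no-cycle₃⇒transitive : (∀ i j k → ¬ Cycle₃ D i j k) → Transitive (Arc D)
  no-cycle₃⇒transitive no-cycle {i} {j} {k} ij jk with i ≟ k
  ... | yes refl = ⊥-elim (proj₂ tournament i j (arc⇒≢ ij) (trans ij (sym jk)))
  ... | no i≢k with D i k in ik
  ...   | true  = refl
  ...   | false = ⊥-elim (no-cycle i j k (ij , jk , trans (converse i≢k) (cong not ik)))

  acyclic⇔no-cycle₃ : Acyclic D ⇔ (∀ i j k → ¬ Cycle₃ D i j k)
  acyclic⇔no-cycle₃ = mk⇔
    (λ acyclic i j k (ij , jk , ki) → acyclic i (ij ∷ jk ∷ [ ki ]))
    (λ no-cycle i ii → no-loop (transitive⁻ (Arc D) (no-cycle₃⇒transitive no-cycle) ii))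

⊕-tournament : ∀ {n ℓ} {D : Digraph n} → IsTournament D →
               (Ys : Vec (VSet n) ℓ) → IsTournament (D ⊕ Ys)
⊕-tournament tournament []       = tournament
⊕-tournament tournament (Y ∷ Ys) = ⊕-tournament (invert-tournament tournament Y) Ys

⊕-arc : ∀ {n ℓ} {D : Digraph n} → IsTournament D → (Ys : Vec (VSet n) ℓ) →
        ∀ {i j} → i ≢ j → (D ⊕ Ys) i j ≡ (incidence Ys i · incidence Ys j) xor D i j
⊕-arc tournament []       i≢j = refl
⊕-arc {D = D} tournament (Y ∷ Ys) {i} {j} i≢j = begin
  (invert D Y ⊕ Ys) i j  ≡⟨ ⊕-arc (invert-tournament tournament Y) Ys i≢j ⟩
  q xor invert D Y i j   ≡⟨ cong (q xor_) (invert-arc tournament Y i≢j) ⟩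
  q xor (r xor D i j)    ≡⟨ xor-assoc q r (D i j) ⟨
  (q xor r) xor D i j    ≡⟨ cong (_xor D i j) (xor-comm q r) ⟩
  (r xor q) xor D i j    ∎
  where
  open ≡-Reasoning
  q = incidence Ys i · incidence Ys j
  r = Y i ∧ Y j

bad-cases : ∀ {x y z : Bool} → (x ≡ y × x ≢ z) ⇔
            ((x ≡ false × y ≡ false × z ≡ true) ⊎ (z ≡ false × y ≡ true × x ≡ true))
bad-cases = mk⇔ cases bad
  where
  cases : ∀ {x y z} → x ≡ y × x ≢ z →
          (x ≡ false × y ≡ false × z ≡ true) ⊎ (z ≡ false × y ≡ true × x ≡ true)
  cases {false} {z = false} (refl , x≢z) = ⊥-elim (x≢z refl)
  cases {false} {z = true}  (refl , _)   = inj₁ (refl , refl , refl)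
  cases {true}  {z = false} (refl , _)   = inj₂ (refl , refl , refl)
  cases {true}  {z = true}  (refl , x≢z) = ⊥-elim (x≢z refl)

  bad : ∀ {x y z} →
        (x ≡ false × y ≡ false × z ≡ true) ⊎ (z ≡ false × y ≡ true × x ≡ true) →
        x ≡ y × x ≢ z
  bad (inj₁ (refl , refl , refl)) = refl , λ ()
  bad (inj₂ (refl , refl , refl)) = refl , λ ()

module _ {n m} {D : Digraph n} (tournament : IsTournament D) (u : Fin n → Vec Bool m)
         (encoded : ∀ {a b} → a < b → D a b ≡ not (u a · u b)) where

  encoded-converse : ∀ {a b} → a < b → D b a ≡ u a · u b
  encoded-converse {a} {b} a<b = begin
    D b a                 ≡⟨ converse tournament (<⇒≢ a<b) ⟩
    not (D a b)           ≡⟨ cong not (encoded a<b) ⟩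
    not (not (u a · u b)) ≡⟨ not-involutive (u a · u b) ⟩
    u a · u b             ∎
    where open ≡-Reasoning

  forward-arc⇔ : ∀ {a b} → a < b → Arc D a b ⇔ (u a · u b ≡ false)
  forward-arc⇔ a<b =
    mk⇔ (not-injective ∘ trans (sym (encoded a<b))) (trans (encoded a<b) ∘ cong not)

  backward-arc⇔ : ∀ {a b} → a < b → Arc D b a ⇔ (u a · u b ≡ true)
  backward-arc⇔ a<b = mk⇔ (trans (sym (encoded-converse a<b))) (trans (encoded-converse a<b))

  bad⇔cycle₃ : ∀ {a b c} → a < b → b < c →
               Bad (u a) (u b) (u c) ⇔ (Cycle₃ D a b c ⊎ Cycle₃ D a c b)
  bad⇔cycle₃ a<b b<c =
    ⇔-sym ((forward-arc⇔ a<b ×-⇔ forward-arc⇔ b<c ×-⇔ backward-arc⇔ a<c)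
       ⊎-⇔ (forward-arc⇔ a<c ×-⇔ backward-arc⇔ b<c ×-⇔ backward-arc⇔ a<b))
    ⇔-∘ bad-cases
    where a<c = <-trans a<b b<c

  no-cycle₃⇒no-bad-triple : (∀ i j k → ¬ Cycle₃ D i j k) → NoBadTriple u
  no-cycle₃⇒no-bad-triple no-cycle a b c a<b b<c bad =
    [ no-cycle a b c , no-cycle a c b ]′ (to (bad⇔cycle₃ a<b b<c) bad)

  module _ (no-bad : NoBadTriple u) where

    no-cycle₃-from-min : ∀ {i j k} → i < j → i < k → ¬ Cycle₃ D i j k
    no-cycle₃-from-min {i} {j} {k} i<j i<k cycle with <-cmp j k
    ... | tri< j<k _ _  = no-bad i j k i<j j<k (from (bad⇔cycle₃ i<j j<k) (inj₁ cycle))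
    ... | tri≈ _ refl _ = no-loop tournament (proj₁ (proj₂ cycle))
    ... | tri> _ _ k<j  = no-bad i k j i<k k<j (from (bad⇔cycle₃ i<k k<j) (inj₂ cycle))

    -- A cycle may be rotated so that it starts at its least vertex.
    no-bad-triple⇒no-cycle₃ : ∀ i j k → ¬ Cycle₃ D i j k
    no-bad-triple⇒no-cycle₃ i j k (ij , jk , ki) with <-cmp i j | <-cmp i k
    ... | tri≈ _ refl _ | _             = no-loop tournament ij
    ... | tri< i<j _ _  | tri< i<k _ _  = no-cycle₃-from-min i<j i<k (ij , jk , ki)
    ... | tri< _ _ _    | tri≈ _ refl _ = no-loop tournament ki
    ... | tri< i<j _ _  | tri> _ _ k<i  = no-cycle₃-from-min k<i (<-trans k<i i<j) (ki , ij , jk)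
    ... | tri> _ _ j<i  | _ with <-cmp j k
    ...   | tri< j<k _ _  = no-cycle₃-from-min j<k j<i (jk , ki , ij)
    ...   | tri≈ _ refl _ = no-loop tournament jk
    ...   | tri> _ _ k<j  = no-cycle₃-from-min (<-trans k<j j<i) k<j (ki , ij , jk)

  acyclic⇔no-bad-triple : Acyclic D ⇔ NoBadTriple u
  acyclic⇔no-bad-triple =
    mk⇔ no-cycle₃⇒no-bad-triple no-bad-triple⇒no-cycle₃ ⇔-∘ acyclic⇔no-cycle₃ tournament

module _ {n s} {T₀ : Digraph n} (tournament : IsTournament T₀) (X : Vec (VSet n) s)
         (ordered : ∀ i j → i < j → (T₀ ⊕ X) i j ≡ true) where

  ⊕-encoded : ∀ {k} (Ys : Vec (VSet n) k) {a b} → a < b →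
    (T₀ ⊕ Ys) a b ≡
      not ((incidence X a ++ incidence Ys a) · (incidence X b ++ incidence Ys b))
  ⊕-encoded Ys {a} {b} a<b = begin
    (T₀ ⊕ Ys) a b                     ≡⟨ ⊕-arc tournament Ys a≢b ⟩
    q xor T₀ a b                      ≡⟨ cong (q xor_) T₀-ab ⟩
    q xor not p                       ≡⟨ not-distribʳ-xor q p ⟨
    not (q xor p)                     ≡⟨ cong not (xor-comm q p) ⟩
    not (p xor q)                     ≡⟨ cong not (·-++ (x a) (x b) (y a) (y b)) ⟨
    not ((x a ++ y a) · (x b ++ y b)) ∎
    where
    open ≡-Reasoning
    x = incidence X
    y = incidence Ys
    a≢b = <⇒≢ a<b
    p = x a · x b
    q = y a · y b
    T₀-ab : T₀ a b ≡ not p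
    T₀-ab = xor≡true⇒≡not p (trans (sym (⊕-arc tournament X a≢b)) (ordered a b a<b))

  decycling⇔no-bad-triple : ∀ {k} (Ys : Vec (VSet n) k) (u : Fin n → Vec Bool (s + k)) →
    (∀ i → u i ≡ incidence X i ++ incidence Ys i) → IsDecycling T₀ Ys ⇔ NoBadTriple u
  decycling⇔no-bad-triple Ys u u≡ =
    acyclic⇔no-bad-triple (⊕-tournament tournament Ys) u encoded
    where
    encoded : ∀ {a b} → a < b → (T₀ ⊕ Ys) a b ≡ not (u a · u b)
    encoded {a} {b} a<b rewrite u≡ a | u≡ b = ⊕-encoded Ys a<b

lemma5 : (n s k : ℕ) → 3 ≤ n →
    (T₀ : Digraph n) → IsTournament T₀ →
    (A : Fin n → ℕ → Bool) →
    (∀ i m → A i m ≡ true → m ≤ k) →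
    (∀ i → ∃ λ m → A i m ≡ true) →
    (X : Vec (VSet n) s) → IsDecycling T₀ X →
    (∀ i j → i < j → (T₀ ⊕ X) i j ≡ true) →
    IsYesInstance T₀ k A X ⇔ ExistsGoodB k A X
lemma5 n s k _ T₀ tournament A _ _ X _ ordered = mk⇔ yes⇒good good⇒yes
  where
  yes⇒good : IsYesInstance T₀ k A X → ExistsGoodB k A X
  yes⇒good (Ys , decycling , multiplicity∈A) =
    u , u∈J , to (decycling⇔no-bad-triple tournament X ordered Ys u (λ _ → refl)) decycling
    where
    u : Fin n → Vec Bool (s + k)
    u i = incidence X i ++ incidence Ys i
    u∈J : ∀ i → InJ k A X i (u i)
    u∈J i = let take≡ , drop≡ = take-drop-++ s (incidence X i) (incidence Ys i) in
      take≡ , subst (λ v → A i (countTrue v) ≡ true) (sym drop≡) (multiplicity∈A i)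

  good⇒yes : ExistsGoodB k A X → IsYesInstance T₀ k A X
  good⇒yes (u , u∈J , no-bad) =
    Ys , from (decycling⇔no-bad-triple tournament X ordered Ys u split) no-bad , multiplicity∈A
    where
    Ys : Vec (VSet n) k
    Ys = columns (drop s ∘ u)
    split : ∀ i → u i ≡ incidence X i ++ incidence Ys i
    split i = trans (sym (take++drop≡id s (u i)))
                    (cong₂ _++_ (proj₁ (u∈J i)) (sym (incidence-columns (drop s ∘ u) i)))
    multiplicity∈A : ∀ i → A i (multiplicity Ys i) ≡ true
    multiplicity∈A i = subst (λ v → A i (countTrue v) ≡ true)
                             (sym (incidence-columns (drop s ∘ u) i)) (proj₂ (u∈J i))
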